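{- Fix a natural number $m$. The logic $LTL_{Past,m}$ is decidable, and its satisfiability problem is decidable: there is an algorithm which, for any formula, determines whether it is satisfiable (true at some state of some model of $LTL_{Past,m}$) and, if so, computes a valuation of a model satisfying the formula.
   Context: Formulas are built from propositional letters by Boolean connectives, the unary operation $\mathbf{N}$ (next) and the binary operation $\mathbf{S}$ (since). Fix a natural number $m$ (measure of intransitivity). A frame is $\langle \mathbb{N},\geq,\mathrm{Next},\bigcup_{i\in\mathbb{N}}R_i\rangle$ where $R_i$ is the order $\geq$ restricted to the interval $[i,i+m]$ (so $b\,R_a\,a$ iff $a\le b\le a+m$). A model is such a frame with a valuation $V$ assigning to each letter a subset of $\mathbb{N}$. Truth: letters via $V$; Boolean connectives as usual; $(\mathcal{M},a)\models\mathbf{N}\varphi$ iff $(\mathcal{M},a+1)\models\varphi$; $(\mathcal{M},a)\models\varphi\,\mathbf{S}\,\psi$ iff there is $b$ with $b\,R_a\,a$, $(\mathcal{M},b)\models\psi$ and $(\mathcal{M},c)\models\varphi$ for all $c$ with $a\le c<b$. $LTL_{Past,m}$ is the set of formulas true at all states of all such models. -}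

module Defs where

open import Data.Nat using (ℕ; suc; _+_; _≤_; _<_)
open import Data.Bool using (Bool; T)
open import Data.Empty using (⊥)
open import Data.Product using (Σ; _×_)
open import Data.Sum using (_⊎_)
open import Relation.Nullary using (¬_)

data Formula : Set where
  var  : ℕ → Formula
  ⊥'   : Formula
  ¬'_  : Formula → Formula
  _∧'_ : Formula → Formula → Formula
  _∨'_ : Formula → Formula → Formula
  _⇒'_ : Formula → Formula → Formula
  N    : Formula → Formula
  _S_  : Formula → Formula → Formula

-- A valuation assigns to each letter a (decidable) subset of ℕ.
Valuation : Set
Valuation = ℕ → ℕ → Bool

-- Truth at state a of the model with intransitivity measure m and valuation V.
-- b R_a a  iff  a ≤ b ≤ a + m.
Sat : (m : ℕ) → Valuation → ℕ → Formula → Set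
Sat m V a (var p)   = T (V p a)
Sat m V a ⊥'        = ⊥
Sat m V a (¬' φ)    = ¬ Sat m V a φ
Sat m V a (φ ∧' ψ)  = Sat m V a φ × Sat m V a ψ
Sat m V a (φ ∨' ψ)  = Sat m V a φ ⊎ Sat m V a ψ
Sat m V a (φ ⇒' ψ)  = Sat m V a φ → Sat m V a ψ
Sat m V a (N φ)     = Sat m V (suc a) φ
Sat m V a (φ S ψ)   =
  Σ ℕ λ b → (a ≤ b) × (b ≤ a + m) × Sat m V b ψ
          × ((c : ℕ) → a ≤ c → c < b → Sat m V c φ)

-- φ ∈ LTL_{Past,m}: true at all states of all models
Valid : ℕ → Formula → Set
Valid m φ = (V : Valuation) (a : ℕ) → Sat m V a φ

Satisfiable : ℕ → Formula → Set
Satisfiable m φ = Σ Valuation λ V → Σ ℕ λ a → Sat m V a φ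

module Submission where

-- Since S only looks at most m steps into the future and N exactly one step,
-- the truth of φ at a state x depends only on the letters occurring in φ
-- (all below  letters φ ) and on the states x, x+1, …, x + lookahead φ.  Consequently φ is
-- satisfiable iff it holds at state 0 of a valuation read off a finite
-- Boolean window (letters φ) × (lookahead φ + 1); there are finitely many
-- windows, so satisfiability is decidable by exhaustive search, and the
-- witnessing window yields the valuation.  Validity is decided by duality:
-- φ is valid iff ¬φ is unsatisfiable.

open import Defs
open import Data.Nat using (ℕ; zero; suc; _+_; _∸_; _≤_; _<_; _⊔_; z≤n; s≤s)
open import Data.Nat.Properties
open import Data.Bool using (Bool; false; T; T?)
open import Data.Vec using (Vec; []; _∷_; replicate)
open import Data.Fin.Subset.Properties using (anySubset?)
open import Data.Product using (_×_; ∃; _,_)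
open import Data.Sum using (inj₁; inj₂)
open import Relation.Unary using (Decidable)
open import Relation.Nullary using (Dec; no)
open import Relation.Nullary.Decidable
  using (map′; decidable-stable; _×-dec_; _⊎-dec_; _→-dec_; ¬?)
open import Relation.Binary.PropositionalEquality
  using (_≡_; refl; sym; trans; cong; subst)

Searchable : Set → Set₁
Searchable A = {P : A → Set} → Decidable P → Dec (∃ P)

searchVec : {A : Set} → Searchable A → (n : ℕ) → Searchable (Vec A n)
searchVec search zero P? = map′ ([] ,_) (λ { ([] , p) → p }) (P? [])
searchVec search (suc n) P? =
  map′ (λ (x , xs , p) → x ∷ xs , p) (λ { (x ∷ xs , p) → x , xs , p })
       (search (λ x → searchVec search n (λ xs → P? (x ∷ xs))))

at : {A : Set} {n : ℕ} → A → Vec A n → ℕ → A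
at d []       i       = d
at d (x ∷ xs) zero    = x
at d (x ∷ xs) (suc i) = at d xs i

sample : {A : Set} → (ℕ → A) → (n : ℕ) → Vec A n
sample f zero    = []
sample f (suc n) = f 0 ∷ sample (λ i → f (suc i)) n

at-sample : {A : Set} (d : A) (f : ℕ → A) (n i : ℕ) → i < n → at d (sample f n) i ≡ f i
at-sample d f (suc n) zero    _         = refl
at-sample d f (suc n) (suc i) (s≤s i<n) = at-sample d (λ i → f (suc i)) n i i<n

-- A window records the values of P letters at D consecutive states.
Window : ℕ → ℕ → Set
Window P D = Vec (Vec Bool D) P

-- The valuation described by a window, starting at state 0 (false elsewhere).
decode : {P D : ℕ} → Window P D → Valuation
decode {D = D} w p j = at false (at (replicate D false) w p) j

snapshot : Valuation → ℕ → (P D : ℕ) → Window P D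
snapshot V x P D = sample (λ p → sample (λ j → V p (x + j)) D) P

decode-snapshot : (V : Valuation) (x P D p j : ℕ) → p < P → j < D →
                  decode (snapshot V x P D) p j ≡ V p (x + j)
decode-snapshot V x P D p j p<P j<D =
  trans (cong (λ row → at false row j)
              (at-sample _ (λ p → sample (λ j → V p (x + j)) D) P p p<P))
        (at-sample false (λ j → V p (x + j)) D j j<D)

record Agree (V : Valuation) (x : ℕ) (W : Valuation) (y : ℕ) (P d : ℕ) : Set where
  constructor agree
  field same : ∀ {p j} → p < P → j ≤ d → V p (x + j) ≡ W p (y + j)
open Agree

module _ {V : Valuation} {x : ℕ} {W : Valuation} {y : ℕ} where

  Agree-sym : ∀ {P d} → Agree V x W y P d → Agree W y V x P d
  Agree-sym ag = agree λ p<P j≤d → sym (same ag p<P j≤d)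

  Agree-mono : ∀ {P d P′ d′} → P′ ≤ P → d′ ≤ d → Agree V x W y P d → Agree V x W y P′ d′
  Agree-mono P′≤P d′≤d ag = agree λ p<P′ j≤d′ → same ag (<-≤-trans p<P′ P′≤P) (≤-trans j≤d′ d′≤d)

  Agree-shift : ∀ {P d d′} t → t + d′ ≤ d → Agree V x W y P d → Agree V (x + t) W (y + t) P d′
  Agree-shift t t+d′≤d ag = agree λ {p} {j} p<P j≤d′ →
    trans (cong (V p) (+-assoc x t j))
          (trans (same ag p<P (≤-trans (+-monoʳ-≤ t j≤d′) t+d′≤d))
                 (cong (W p) (sym (+-assoc y t j))))

  Agree-next : ∀ {P d} → Agree V x W y P (suc d) → Agree V (suc x) W (suc y) P d
  Agree-next ag = agree λ {p} {j} p<P j≤d →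
    trans (cong (V p) (sym (+-suc x j)))
          (trans (same ag p<P (s≤s j≤d)) (cong (W p) (+-suc y j)))

  Agree-left : ∀ {P₁ P₂ d₁ d₂} → Agree V x W y (P₁ ⊔ P₂) (d₁ ⊔ d₂) → Agree V x W y P₁ d₁
  Agree-left = Agree-mono (m≤m⊔n _ _) (m≤m⊔n _ _)

  Agree-right : ∀ {P₁ P₂ d₁ d₂} → Agree V x W y (P₁ ⊔ P₂) (d₁ ⊔ d₂) → Agree V x W y P₂ d₂
  Agree-right = Agree-mono (m≤n⊔m _ _) (m≤n⊔m _ _)

letters : Formula → ℕ
letters (var p)  = suc p
letters ⊥'       = 0
letters (¬' φ)   = letters φ
letters (φ ∧' ψ) = letters φ ⊔ letters ψ
letters (φ ∨' ψ) = letters φ ⊔ letters ψ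
letters (φ ⇒' ψ) = letters φ ⊔ letters ψ
letters (N φ)    = letters φ
letters (φ S ψ)  = letters φ ⊔ letters ψ

module _ (m : ℕ) where

  -- The truth of φ at x depends only on states x, …, x + lookahead φ.
  lookahead : Formula → ℕ
  lookahead (var p)  = 0
  lookahead ⊥'       = 0
  lookahead (¬' φ)   = lookahead φ
  lookahead (φ ∧' ψ) = lookahead φ ⊔ lookahead ψ
  lookahead (φ ∨' ψ) = lookahead φ ⊔ lookahead ψ
  lookahead (φ ⇒' ψ) = lookahead φ ⊔ lookahead ψ
  lookahead (N φ)    = suc (lookahead φ)
  lookahead (φ S ψ)  = m + (lookahead φ ⊔ lookahead ψ)

  -- φ S ψ at a, with the witness b = a + t written as an offset t ≤ m.
  SinceWindow : Valuation → ℕ → Formula → Formula → Set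
  SinceWindow V a φ ψ =
    ∃ λ t → t < suc m × Sat m V (a + t) ψ × (∀ {s} → s < t → Sat m V (a + s) φ)

  since⇒window : ∀ V a φ ψ → Sat m V a (φ S ψ) → SinceWindow V a φ ψ
  since⇒window V a φ ψ (b , a≤b , b≤a+m , sψ , sφ) =
    b ∸ a , s≤s (m≤n+o⇒m∸n≤o b a b≤a+m) , subst (λ c → Sat m V c ψ) (sym a+t≡b) sψ ,
    λ {s} s<t → sφ (a + s) (m≤m+n a s) (subst (a + s <_) a+t≡b (+-monoʳ-< a s<t))
    where a+t≡b = m+[n∸m]≡n a≤b

  window⇒since : ∀ V a φ ψ → SinceWindow V a φ ψ → Sat m V a (φ S ψ)
  window⇒since V a φ ψ (t , s≤s t≤m , sψ , sφ) =
    a + t , m≤m+n a t , +-monoʳ-≤ a t≤m , sψ ,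
    λ c a≤c c<a+t → let a+s≡c = m+[n∸m]≡n a≤c in
      subst (λ c → Sat m V c φ) a+s≡c
            (sφ (+-cancelˡ-< a (c ∸ a) t (subst (_< a + t) (sym a+s≡c) c<a+t)))

  sat? : ∀ V a φ → Dec (Sat m V a φ)
  sat? V a (var p)  = T? (V p a)
  sat? V a ⊥'       = no λ ()
  sat? V a (¬' φ)   = ¬? (sat? V a φ)
  sat? V a (φ ∧' ψ) = sat? V a φ ×-dec sat? V a ψ
  sat? V a (φ ∨' ψ) = sat? V a φ ⊎-dec sat? V a ψ
  sat? V a (φ ⇒' ψ) = sat? V a φ →-dec sat? V a ψ
  sat? V a (N φ)    = sat? V (suc a) φ
  sat? V a (φ S ψ)  = map′ (window⇒since V a φ ψ) (since⇒window V a φ ψ)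
    (anyUpTo? (λ t → sat? V (a + t) ψ ×-dec allUpTo? (λ s → sat? V (a + s) φ) t) (suc m))

  locality : ∀ φ {V x W y} → Agree V x W y (letters φ) (lookahead φ) →
             Sat m V x φ → Sat m W y φ
  locality (var p) {V} {x} {W} {y} ag s =
    subst T (trans (cong (V p) (sym (+-identityʳ x)))
                   (trans (same ag ≤-refl z≤n) (cong (W p) (+-identityʳ y)))) s
  locality ⊥'       ag ()
  locality (¬' φ)   ag ¬sφ sφ = ¬sφ (locality φ (Agree-sym ag) sφ)
  locality (φ ∧' ψ) ag (sφ , sψ) =
    locality φ (Agree-left ag) sφ , locality ψ (Agree-right ag) sψ
  locality (φ ∨' ψ) ag (inj₁ sφ) = inj₁ (locality φ (Agree-left ag) sφ)
  locality (φ ∨' ψ) ag (inj₂ sψ) = inj₂ (locality ψ (Agree-right ag) sψ)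
  locality (φ ⇒' ψ) ag φ→ψ sφ =
    locality ψ (Agree-right ag) (φ→ψ (locality φ (Agree-sym (Agree-left ag)) sφ))
  locality (N φ) ag sφ = locality φ (Agree-next ag) sφ
  locality (φ S ψ) {V} {x} {W} {y} ag s
    with since⇒window V x φ ψ s
  ... | t , t<1+m@(s≤s t≤m) , sψ , sφ =
    window⇒since W y φ ψ
      ( t , t<1+m
      , locality ψ (Agree-shift t (+-mono-≤ t≤m (m≤n⊔m _ _)) (Agree-mono (m≤n⊔m _ _) ≤-refl ag)) sψ
      , λ {s} s<t → locality φ
          (Agree-shift s (+-mono-≤ (≤-trans (<⇒≤ s<t) t≤m) (m≤m⊔n _ _))
                       (Agree-mono (m≤m⊔n _ _) ≤-refl ag))
          (sφ s<t))

  small-model : ∀ φ → Satisfiable m φ →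
                ∃ λ (w : Window (letters φ) (suc (lookahead φ))) → Sat m (decode w) 0 φ
  small-model φ (V , x , s) =
    snapshot V x P D , locality φ (agree λ p<P j≤d → sym (decode-snapshot V x P D _ _ p<P (s≤s j≤d))) s
    where P = letters φ ; D = suc (lookahead φ)

  satisfiable? : ∀ φ → Dec (Satisfiable m φ)
  satisfiable? φ =
    map′ (λ (w , s) → decode w , 0 , s) (small-model φ)
         (searchVec anySubset? (letters φ) (λ w → sat? (decode w) 0 φ))

  valid? : ∀ φ → Dec (Valid m φ)
  valid? φ =
    map′ (λ unsat V a → decidable-stable (sat? V a φ) (λ ¬sφ → unsat (V , a , ¬sφ)))
         (λ valid (V , a , ¬sφ) → ¬sφ (valid V a))
         (¬? (satisfiable? (¬' φ)))

theorem2 : (m : ℕ) →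
    ((φ : Formula) → Dec (Valid m φ)) × ((φ : Formula) → Dec (Satisfiable m φ))
theorem2 m = valid? m , satisfiable? m
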